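{- Let $2 \leq \ell \leq k \leq \frac{q^n-1}{q-1}$ with $\ell \leq n$, and assume $k\leq \frac{q^{\ell-1}-1}{q-1}$. Then $\operatorname{Ind}_q(n,k,\ell)=(q-1)\operatorname{Ind}^{{\rm pro}}_q(n,k,\ell)$ if and only if $q=2$.
   Context: For $1\le\ell\le k\le q^n-1$ with $\ell\le n$, $S\subseteq\mathbb{F}_q^n\setminus\{\mathbf 0\}$ is $(k,\ell)$-independent if every subset of $S$ of size $k$ contains $\ell$ linearly independent vectors, and $\operatorname{Ind}_q(n,k,\ell)$ is the maximum size of such $S$. For $1\le\ell\le k\le\frac{q^n-1}{q-1}$ with $\ell\le n$, $S\subseteq\mathbb{P}^{n-1}(\mathbb{F}_q)$ is $(k,\ell)$-pro-independent if every $X\subseteq S$ of size $k$ contains $\ell$ linearly independent points, and $\operatorname{Ind}^{\rm pro}_q(n,k,\ell)$ is the maximum size of such $S$. -}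

module Defs where

open import Level using (_⊔_)
open import Algebra.Bundles using (CommutativeRing)
open import Data.Nat using (ℕ; zero; suc; _≤_)
open import Data.Fin using (Fin)
open import Data.Product using (∃; _×_)
open import Relation.Nullary using (¬_)
open import Relation.Binary.PropositionalEquality using (_≡_)

record IsFiniteField {c ℓ} (R : CommutativeRing c ℓ) (q : ℕ) : Set (c ⊔ ℓ) where
  open CommutativeRing R
  field
    0≉1             : ¬ (0# ≈ 1#)
    inverse         : ∀ x → ¬ (x ≈ 0#) → ∃ λ y → (x * y) ≈ 1#
    enum            : Fin q → Carrier
    enum-injective  : ∀ i j → enum i ≈ enum j → i ≡ j
    enum-surjective : ∀ x → ∃ λ i → x ≈ enum i

InjectiveFin : ∀ {a b} → (Fin a → Fin b) → Set
InjectiveFin f = ∀ i j → f i ≡ f j → i ≡ j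

module _ {c ℓ} (R : CommutativeRing c ℓ) where
  open CommutativeRing R

  Vector : ℕ → Set c
  Vector n = Fin n → Carrier

  _≈ᵥ_ : ∀ {n} → Vector n → Vector n → Set ℓ
  u ≈ᵥ v = ∀ i → u i ≈ v i

  0ᵥ : ∀ n → Vector n
  0ᵥ n = λ _ → 0#

  scale : ∀ {n} → Carrier → Vector n → Vector n
  scale a v = λ i → a * v i

  sumFin : ∀ m → (Fin m → Carrier) → Carrier
  sumFin zero    f = 0#
  sumFin (suc m) f = f Fin.zero + sumFin m (λ j → f (Fin.suc j))

  linComb : ∀ {n m} → (Fin m → Carrier) → (Fin m → Vector n) → Vector n
  linComb {m = m} cs vs = λ i → sumFin m (λ j → cs j * vs j i)

  LinIndep : ∀ {n m} → (Fin m → Vector n) → Set (c ⊔ ℓ)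
  LinIndep {n} {m} vs = ∀ (cs : Fin m → Carrier) → linComb cs vs ≈ᵥ 0ᵥ n → ∀ j → cs j ≈ 0#

  -- every k-element subset (an injective choice of k indices) contains
  -- ℓ' linearly independent vectors (an injective choice of ℓ' of them)
  EveryKSubsetHasIndep : ∀ {n m} → (k l : ℕ) → (Fin m → Vector n) → Set (c ⊔ ℓ)
  EveryKSubsetHasIndep {n} {m} k l S =
    ∀ (f : Fin k → Fin m) → InjectiveFin f →
      ∃ λ (g : Fin l → Fin k) → InjectiveFin g × LinIndep (λ i → S (f (g i)))

  IsIndepSet : (n k l m : ℕ) → (Fin m → Vector n) → Set (c ⊔ ℓ)
  IsIndepSet n k l m S =
      (∀ i → ¬ (S i ≈ᵥ 0ᵥ n))
    × (∀ i j → S i ≈ᵥ S j → i ≡ j)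
    × EveryKSubsetHasIndep k l S

  -- S ⊆ P^{n-1}, |S| = m: points given by nonzero representatives, pairwise
  -- distinct as projective points (not scalar multiples of each other),
  -- and S is (k,l)-pro-independent
  IsProIndepSet : (n k l m : ℕ) → (Fin m → Vector n) → Set (c ⊔ ℓ)
  IsProIndepSet n k l m S =
      (∀ i → ¬ (S i ≈ᵥ 0ᵥ n))
    × (∀ i j → (∃ λ a → S i ≈ᵥ scale a (S j)) → i ≡ j)
    × EveryKSubsetHasIndep k l S

  IsInd : (n k l m : ℕ) → Set (c ⊔ ℓ)
  IsInd n k l m =
      (∃ λ (S : Fin m → Vector n) → IsIndepSet n k l m S)
    × (∀ m' (S : Fin m' → Vector n) → IsIndepSet n k l m' S → m' ≤ m)

  IsIndPro : (n k l m : ℕ) → Set (c ⊔ ℓ)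
  IsIndPro n k l m =
      (∃ λ (S : Fin m → Vector n) → IsProIndepSet n k l m S)
    × (∀ m' (S : Fin m' → Vector n) → IsProIndepSet n k l m' S → m' ≤ m)

{-# OPTIONS --safe #-}

-- For q = 2 the only nonzero scalar is 1, so (k,ℓ)-independent and
-- (k,ℓ)-pro-independent sets are the same thing.
--
-- For q ≥ 3 let S be a maximum (k,ℓ)-independent set and suppose
-- |S| = (q-1) Ind^pro. A system of projective representatives of S is
-- pro-independent, hence has at most Ind^pro points, and S meets each of their
-- lines in at most q-1 points. Equality therefore forces the representatives
-- to be a maximum pro-independent set and S to contain every nonzero multiple
-- of each of them. Then S contains every nonzero vector x: otherwise x could be
-- added to the representatives, because a k-subset through x becomes a k-subset
-- of S on replacing x by c·P, for another of its points P and a scalar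
-- c ∉ {0,1}, and an independent ℓ-subset of the latter cannot contain both c·P
-- and P, so P can stand in for c·P. But S = F^n ∖ {0} is not
-- (k,ℓ)-independent: k < q^(ℓ-1) distinct nonzero vectors of a coordinate
-- subspace of dimension ℓ-1 contain no ℓ independent ones.

module Submission where

open import Defs
open import Level using (_⊔_)
open import Algebra.Bundles using (CommutativeRing)
open import Data.Nat as ℕ using (ℕ; zero; suc; _^_; _∸_; _≤_; _<_; z≤n; s≤s)
import Data.Nat.Properties as ℕ
open import Data.Fin using (Fin; zero; suc; punchIn; punchOut; splitAt; combine; inject≤; finToFun; funToFin; _↑ˡ_)
import Data.Fin.Properties as FinP
open import Data.Vec.Functional using (_∷_; _++_; updateAt; insertAt)
open import Data.Vec.Functional.Properties
  using (updateAt-updates; updateAt-minimal; insertAt-lookup; insertAt-punchIn; lookup-++ˡ)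
open import Data.Product using (∃; ∃₂; _×_; _,_; proj₁; proj₂)
open import Data.Sum using (inj₁; inj₂)
open import Data.Empty using (⊥-elim)
open import Function using (_∘_; const; _⇔_; mk⇔)
open import Relation.Binary.Definitions using (Decidable)
open import Relation.Nullary using (¬_; yes; no; contradiction)
open import Relation.Nullary.Decidable using (map′)
open import Relation.Binary.PropositionalEquality as ≡ using (_≡_; _≢_)

injective⇒surjective : ∀ {m n} {h : Fin m → Fin n} → InjectiveFin h → n ≤ m → ∀ y → ∃ λ i → h i ≡ y
injective⇒surjective {n = zero} _ _ ()
injective⇒surjective {m} {suc n} {h} h-injective n<m y with FinP.any? (λ i → h i FinP.≟ y)
... | yes hit = hit
... | no miss = contradiction (ℕ.≤-trans n<m (FinP.injective⇒≤ h′-injective)) (ℕ.<-irrefl ≡.refl)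
  where
  y∉h : ∀ i → y ≢ h i
  y∉h i y≡hi = miss (i , ≡.sym y≡hi)
  h′ : Fin m → Fin n
  h′ i = punchOut (y∉h i)
  h′-injective : ∀ {i j} → h′ i ≡ h′ j → i ≡ j
  h′-injective {i} {j} = h-injective i j ∘ FinP.punchOut-injective (y∉h i) (y∉h j)

2≤n⇒∃≢ : ∀ {n} → 2 ≤ n → (i : Fin n) → ∃ λ j → j ≢ i
2≤n⇒∃≢ {suc (suc n)} _         i = punchIn i zero , FinP.punchInᵢ≢i i zero
2≤n⇒∃≢ {suc zero}    (s≤s ()) _

updateAt-injective : ∀ {m n} {g : Fin m → Fin n} {s} (u₀ : Fin m) →
  InjectiveFin g → (∀ u → g u ≢ s) → InjectiveFin (updateAt g u₀ (const s))
updateAt-injective {g = g} u₀ g-injective s∉g u u′ eq with u FinP.≟ u₀ | u′ FinP.≟ u₀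
... | yes ≡.refl | yes ≡.refl = ≡.refl
... | yes ≡.refl | no u′≢u₀ = contradiction
  (≡.trans (≡.sym (updateAt-minimal u′ u₀ g u′≢u₀)) (≡.trans (≡.sym eq) (updateAt-updates u₀ g))) (s∉g u′)
... | no u≢u₀ | yes ≡.refl = contradiction
  (≡.trans (≡.sym (updateAt-minimal u u₀ g u≢u₀)) (≡.trans eq (updateAt-updates u₀ g))) (s∉g u)
... | no u≢u₀ | no u′≢u₀ = g-injective u u′
  (≡.trans (≡.sym (updateAt-minimal u u₀ g u≢u₀)) (≡.trans eq (updateAt-minimal u′ u₀ g u′≢u₀)))

funToFin-cong : ∀ {m n} {f g : Fin m → Fin n} → (∀ i → f i ≡ g i) → funToFin f ≡ funToFin g
funToFin-cong {zero}  _   = ≡.refl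
funToFin-cong {suc m} f≗g = ≡.cong₂ combine (f≗g zero) (funToFin-cong (f≗g ∘ suc))

finToFun-injective : ∀ {m n} {x y : Fin (m ^ n)} → (∀ i → finToFun {m} {n} x i ≡ finToFun y i) → x ≡ y
finToFun-injective {m} {n} {x} {y} eq =
  ≡.trans (≡.sym (FinP.funToFin-finToFin {n} {m} x)) (≡.trans (funToFin-cong eq) (FinP.funToFin-finToFin {n} {m} y))

≤∸1⇒< : ∀ {m n} → 0 < n → m ≤ n ∸ 1 → m < n
≤∸1⇒< {n = suc n} _ m≤n = s≤s m≤n

module _ {c ℓ} (F : CommutativeRing c ℓ) where
  open CommutativeRing F hiding (zero)
  open import Algebra.Properties.Ring ring using (-‿distribˡ-*; -‿distribʳ-*)
  open import Algebra.Properties.AbelianGroup +-abelianGroup using (⁻¹-∙-comm)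
  open import Algebra.Properties.CommutativeSemigroup +-commutativeSemigroup using (interchange)
  open import Algebra.Properties.CommutativeMonoid.Sum +-commutativeMonoid using (sum; sum-remove)
  open import Relation.Binary.Reasoning.Setoid setoid

  private
    V : ℕ → Set c
    V = Vector F

    infix 4 _≋_
    _≋_ : ∀ {n} → V n → V n → Set ℓ
    _≋_ = _≈ᵥ_ F

  IsFiniteField⇒2≤q : ∀ {q} → IsFiniteField F q → 2 ≤ q
  IsFiniteField⇒2≤q {zero} FF = ⊥-elim (FinP.¬Fin0 (proj₁ (IsFiniteField.enum-surjective FF 0#)))
  IsFiniteField⇒2≤q {suc zero} FF with IsFiniteField.enum-surjective FF 0# | IsFiniteField.enum-surjective FF 1#
  ... | zero , 0≈e₀ | zero , 1≈e₀ = ⊥-elim (IsFiniteField.0≉1 FF (trans 0≈e₀ (sym 1≈e₀)))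
  IsFiniteField⇒2≤q {suc (suc q)} _ = s≤s (s≤s z≤n)

  sumFin-cong : ∀ m {f g : Fin m → Carrier} → (∀ j → f j ≈ g j) → sumFin F m f ≈ sumFin F m g
  sumFin-cong zero    _   = refl
  sumFin-cong (suc m) f≈g = +-cong (f≈g zero) (sumFin-cong m (f≈g ∘ suc))

  sumFin-zero : ∀ m {f : Fin m → Carrier} → (∀ j → f j ≈ 0#) → sumFin F m f ≈ 0#
  sumFin-zero zero    _   = refl
  sumFin-zero (suc m) f≈0 = trans (+-cong (f≈0 zero) (sumFin-zero m (f≈0 ∘ suc))) (+-identityˡ 0#)

  sumFin≡sum : ∀ m (f : Fin m → Carrier) → sumFin F m f ≡ sum f
  sumFin≡sum zero    f = ≡.refl
  sumFin≡sum (suc m) f = ≡.cong (f zero +_) (sumFin≡sum m (f ∘ suc))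

  sumFin-remove : ∀ {m} (p : Fin (suc m)) (f : Fin (suc m) → Carrier) →
    sumFin F (suc m) f ≈ f p + sumFin F m (f ∘ punchIn p)
  sumFin-remove {m} p f = begin
    sumFin F (suc m) f                ≡⟨ sumFin≡sum (suc m) f ⟩
    sum f                             ≈⟨ sum-remove {i = p} f ⟩
    f p + sum (f ∘ punchIn p)         ≡⟨ ≡.cong (f p +_) (sumFin≡sum m (f ∘ punchIn p)) ⟨
    f p + sumFin F m (f ∘ punchIn p)  ∎

  sumFin-single : ∀ {m} (p : Fin m) (f : Fin m → Carrier) → (∀ j → j ≢ p → f j ≈ 0#) → sumFin F m f ≈ f p
  sumFin-single {suc m} p f vanish = begin
    sumFin F (suc m) f                ≈⟨ sumFin-remove p f ⟩
    f p + sumFin F m (f ∘ punchIn p)  ≈⟨ +-congˡ (sumFin-zero m (λ t → vanish _ (FinP.punchInᵢ≢i p t))) ⟩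
    f p + 0#                          ≈⟨ +-identityʳ (f p) ⟩
    f p                               ∎

  sumFin-linear : ∀ m (cs x d : Fin m → Carrier) y →
    sumFin F m (λ t → cs t * (x t - d t * y)) ≈ sumFin F m (λ t → cs t * x t) - sumFin F m (λ t → cs t * d t) * y
  sumFin-linear zero _ _ _ y = begin
    0#           ≈⟨ -‿inverseʳ 0# ⟨
    0# - 0#      ≈⟨ +-congˡ (-‿cong (zeroˡ y)) ⟨
    0# - 0# * y  ∎
  sumFin-linear (suc m) cs x d y =
    trans (+-congˡ (sumFin-linear m (cs ∘ suc) (x ∘ suc) (d ∘ suc) y)) (regroup (cs zero) (x zero) (d zero) _ _)
    where
    regroup : ∀ s x₀ d₀ A B → s * (x₀ - d₀ * y) + (A - B * y) ≈ (s * x₀ + A) - (s * d₀ + B) * y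
    regroup s x₀ d₀ A B = begin
      s * (x₀ - d₀ * y) + (A - B * y)            ≈⟨ +-congʳ (distribˡ s x₀ (- (d₀ * y))) ⟩
      (s * x₀ + s * - (d₀ * y)) + (A - B * y)    ≈⟨ +-congʳ (+-congˡ (-‿distribʳ-* s (d₀ * y))) ⟨
      (s * x₀ - s * (d₀ * y)) + (A - B * y)      ≈⟨ interchange _ _ _ _ ⟩
      (s * x₀ + A) + (- (s * (d₀ * y)) - B * y)  ≈⟨ +-congˡ (⁻¹-∙-comm _ _) ⟩
      (s * x₀ + A) - (s * (d₀ * y) + B * y)      ≈⟨ +-congˡ (-‿cong (+-congʳ (*-assoc s d₀ y))) ⟨
      (s * x₀ + A) - (s * d₀ * y + B * y)        ≈⟨ +-congˡ (-‿cong (distribʳ y (s * d₀) B)) ⟨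
      (s * x₀ + A) - (s * d₀ + B) * y            ∎

  LinIndep-resp : ∀ {n m} {u v : Fin m → V n} → (∀ j → v j ≋ u j) → LinIndep F u → LinIndep F v
  LinIndep-resp {m = m} v≋u li cs Σ≈0 = li cs (λ i → trans (sumFin-cong m (λ j → *-congˡ (sym (v≋u j i)))) (Σ≈0 i))

  LinIndep-++ : ∀ {d e m} (w : Fin m → V d) → LinIndep F (λ j → w j ++ 0ᵥ F e) → LinIndep F w
  LinIndep-++ {d} {e} {m} w li cs Σ≈0 = li cs Σ′≈0
    where
    Σ′≈0 : linComb F cs (λ j → w j ++ 0ᵥ F e) ≋ 0ᵥ F (d ℕ.+ e)
    Σ′≈0 i with splitAt d i
    ... | inj₁ i′ = Σ≈0 i′
    ... | inj₂ _  = sumFin-zero m (λ j → zeroʳ (cs j))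

  infix 4 _∥_
  _∥_ : ∀ {n} → V n → V n → Set (c ⊔ ℓ)
  u ∥ v = ∃ λ a → u ≋ scale F a v

  ∥-refl : ∀ {n} (u : V n) → u ∥ u
  ∥-refl u = 1# , λ i → sym (*-identityˡ (u i))

  scale-coefficient≉0 : ∀ {n} {u v : V n} {a} → ¬ u ≋ 0ᵥ F n → u ≋ scale F a v → ¬ a ≈ 0#
  scale-coefficient≉0 u≉0 u≋av a≈0 = u≉0 (λ i → trans (u≋av i) (trans (*-congʳ a≈0) (zeroˡ _)))

  record ProjectiveReps {n m} (S : Fin m → V n) : Set (c ⊔ ℓ) where
    field
      count        : ℕ
      rep          : Fin count → Fin m
      rep-distinct : ∀ j j′ → S (rep j) ∥ S (rep j′) → j ≡ j′
      rep-covers   : ∀ i → ∃ λ j → S i ∥ S (rep j)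

    rep-injective : InjectiveFin rep
    rep-injective j j′ eq = rep-distinct j j′ (≡.subst (λ i → S (rep j) ∥ S i) eq (∥-refl _))

  reps-proIndep : ∀ {n k l m} {S : Fin m → V n} → IsIndepSet F n k l m S →
    (R : ProjectiveReps S) → IsProIndepSet F n k l (ProjectiveReps.count R) (S ∘ ProjectiveReps.rep R)
  reps-proIndep (S≉0 , _ , indep) R =
    S≉0 ∘ rep , rep-distinct , λ f f-injective → indep (rep ∘ f) (λ t t′ → f-injective t t′ ∘ rep-injective _ _)
    where open ProjectiveReps R

  proIndepSet⇒indepSet : ∀ {n k l m} {S : Fin m → V n} → IsProIndepSet F n k l m S → IsIndepSet F n k l m S
  proIndepSet⇒indepSet (S≉0 , distinct , indep) =
    S≉0 , (λ i j Si≋Sj → distinct i j (1# , λ x → trans (Si≋Sj x) (sym (*-identityˡ _)))) , indep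

  indepSet⇒proIndepSet : (∀ a → ¬ a ≈ 0# → a ≈ 1#) →
    ∀ {n k l m} {S : Fin m → V n} → IsIndepSet F n k l m S → IsProIndepSet F n k l m S
  indepSet⇒proIndepSet units≈1 {S = S} (S≉0 , S-injective , indep) = S≉0 , distinct , indep
    where
    distinct : ∀ i j → S i ∥ S j → i ≡ j
    distinct i j (a , Si≋aSj) = S-injective i j (λ x → trans (Si≋aSj x)
      (trans (*-congʳ (units≈1 a (scale-coefficient≉0 (S≉0 i) Si≋aSj))) (*-identityˡ _)))

  isInd∧isIndPro⇒≡ : (∀ a → ¬ a ≈ 0# → a ≈ 1#) →
    ∀ {n k l m mp} → IsInd F n k l m → IsIndPro F n k l mp → m ≡ mp
  isInd∧isIndPro⇒≡ units≈1 {m = m} {mp} ((S , S-indep) , S-max) ((P , P-proIndep) , P-max) =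
    ℕ.≤-antisym (P-max m S (indepSet⇒proIndepSet units≈1 S-indep)) (S-max mp P (proIndepSet⇒indepSet P-proIndep))

  module DiscreteField
    (0≉1 : ¬ 0# ≈ 1#)
    (inverse : ∀ x → ¬ x ≈ 0# → ∃ λ y → x * y ≈ 1#)
    (_≟_ : Decidable _≈_)
    where

    inv : ∀ x → ¬ x ≈ 0# → Carrier
    inv x x≉0 = proj₁ (inverse x x≉0)

    inv-inverseˡ : ∀ x (x≉0 : ¬ x ≈ 0#) → inv x x≉0 * x ≈ 1#
    inv-inverseˡ x x≉0 = trans (*-comm _ x) (proj₂ (inverse x x≉0))

    inv≉0 : ∀ x (x≉0 : ¬ x ≈ 0#) → ¬ inv x x≉0 ≈ 0#
    inv≉0 x x≉0 x⁻¹≈0 = 0≉1 (begin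
      0#            ≈⟨ zeroʳ x ⟨
      x * 0#        ≈⟨ *-congˡ x⁻¹≈0 ⟨
      x * inv x x≉0 ≈⟨ proj₂ (inverse x x≉0) ⟩
      1#            ∎)

    *-cancelˡ : ∀ {x a b} → ¬ x ≈ 0# → x * a ≈ x * b → a ≈ b
    *-cancelˡ {x} {a} {b} x≉0 xa≈xb = begin
      a                     ≈⟨ *-identityˡ a ⟨
      1# * a                ≈⟨ *-congʳ (inv-inverseˡ x x≉0) ⟨
      inv x x≉0 * x * a     ≈⟨ *-assoc _ x a ⟩
      inv x x≉0 * (x * a)   ≈⟨ *-congˡ xa≈xb ⟩
      inv x x≉0 * (x * b)   ≈⟨ *-assoc _ x b ⟨
      inv x x≉0 * x * b     ≈⟨ *-congʳ (inv-inverseˡ x x≉0) ⟩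
      1# * b                ≈⟨ *-identityˡ b ⟩
      b                     ∎

    *≈0⇒≈0 : ∀ {x y} → ¬ x ≈ 0# → x * y ≈ 0# → y ≈ 0#
    *≈0⇒≈0 {x} x≉0 xy≈0 = *-cancelˡ x≉0 (trans xy≈0 (sym (zeroʳ x)))

    scale-invert : ∀ {n} {u v : V n} {a} (a≉0 : ¬ a ≈ 0#) → u ≋ scale F a v → v ≋ scale F (inv a a≉0) u
    scale-invert {v = v} {a} a≉0 u≋av i = begin
      v i                   ≈⟨ *-identityˡ (v i) ⟨
      1# * v i              ≈⟨ *-congʳ (inv-inverseˡ a a≉0) ⟨
      inv a a≉0 * a * v i   ≈⟨ *-assoc _ a (v i) ⟩
      inv a a≉0 * (a * v i) ≈⟨ *-congˡ (u≋av i) ⟨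
      inv a a≉0 * _         ∎

    ∥-sym : ∀ {n} {u v : V n} → ¬ u ≋ 0ᵥ F n → u ∥ v → v ∥ u
    ∥-sym u≉0 (a , u≋av) = let a≉0 = scale-coefficient≉0 u≉0 u≋av in inv a a≉0 , scale-invert a≉0 u≋av

    infix 4 _≋?_
    _≋?_ : ∀ {n} → Decidable (_≋_ {n})
    u ≋? v = FinP.all? (λ i → u i ≟ v i)

    nonzero-coordinate : ∀ {n} {v : V n} → ¬ v ≋ 0ᵥ F n → ∃ λ i → ¬ v i ≈ 0#
    nonzero-coordinate {n} {v} = FinP.¬∀⟶∃¬ n _ (λ i → v i ≟ 0#)

    scale-fixed⇒≈1 : ∀ {n} {v : V n} {a} → ¬ v ≋ 0ᵥ F n → v ≋ scale F a v → a ≈ 1#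
    scale-fixed⇒≈1 {v = v} {a} v≉0 v≋av with nonzero-coordinate v≉0
    ... | i , vᵢ≉0 = *-cancelˡ vᵢ≉0 (begin
      v i * a   ≈⟨ *-comm (v i) a ⟩
      a * v i   ≈⟨ v≋av i ⟨
      v i       ≈⟨ *-identityʳ (v i) ⟨
      v i * 1#  ∎)

    LinIndep-scale : ∀ {n m} {u v : Fin m → V n} →
      (∀ j → ∃ λ b → ¬ b ≈ 0# × v j ≋ scale F b (u j)) → LinIndep F u → LinIndep F v
    LinIndep-scale {n} {m} {u} v≋bu li cs Σ≈0 j =
      *≈0⇒≈0 (proj₁ (proj₂ (v≋bu j))) (trans (*-comm _ (cs j)) (li (λ j → cs j * b j) Σ′≈0 j))
      where
      b : Fin m → Carrier
      b j = proj₁ (v≋bu j)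
      Σ′≈0 : linComb F (λ j → cs j * b j) u ≋ 0ᵥ F n
      Σ′≈0 i = trans (sumFin-cong m (λ j → trans (*-assoc _ _ _) (*-congˡ (sym (proj₂ (proj₂ (v≋bu j)) i))))) (Σ≈0 i)

    LinIndep⇒parallel⇒≡ : ∀ {n m} {u : Fin m → V n} {t s a} → LinIndep F u → u t ≋ scale F a (u s) → t ≡ s
    LinIndep⇒parallel⇒≡ {n} {suc m} {u} {t} {s} {a} li uₜ≋auₛ with t FinP.≟ s
    ... | yes t≡s = t≡s
    ... | no t≢s = contradiction (trans (reflexive (≡.sym (insertAt-lookup cs′ t 1#))) (li cs relation t)) (0≉1 ∘ sym)
      where
      s′ : Fin m
      s′ = punchOut t≢s
      cs′ : Fin m → Carrier
      cs′ = updateAt (λ _ → 0#) s′ (const (- a))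
      -- the coefficients of the relation u t - a · u s = 0
      cs : Fin (suc m) → Carrier
      cs = insertAt cs′ t 1#
      relation : linComb F cs u ≋ 0ᵥ F n
      relation i = begin
        sumFin F (suc m) (λ j → cs j * u j i)
          ≈⟨ sumFin-remove t (λ j → cs j * u j i) ⟩
        cs t * u t i + sumFin F m (λ j → cs (punchIn t j) * u (punchIn t j) i)
          ≈⟨ +-congˡ (sumFin-single s′ _ (λ j j≢s′ → trans (*-congʳ (reflexive (≡.trans
               (insertAt-punchIn cs′ t 1# j) (updateAt-minimal j s′ _ j≢s′)))) (zeroˡ _))) ⟩
        cs t * u t i + cs (punchIn t s′) * u (punchIn t s′) i
          ≡⟨ ≡.cong₂ (λ x y → x * u t i + y) (insertAt-lookup cs′ t 1#) (≡.cong₂ _*_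
               (≡.trans (insertAt-punchIn cs′ t 1# s′) (updateAt-updates s′ _))
               (≡.cong (λ j → u j i) (FinP.punchIn-punchOut t≢s))) ⟩
        1# * u t i + - a * u s i
          ≈⟨ +-cong (trans (*-identityˡ _) (uₜ≋auₛ i)) (sym (-‿distribˡ-* a (u s i))) ⟩
        a * u s i - a * u s i
          ≈⟨ -‿inverseʳ _ ⟩
        0# ∎

    eliminate : ∀ {m d} → (Fin (suc m) → V (suc d)) → Fin (suc m) → (Fin m → Carrier) → Fin m → V d
    eliminate v p μ t i = v (punchIn p t) (suc i) - μ t * v p (suc i)

    LinIndep-eliminate : ∀ {m d} (v : Fin (suc m) → V (suc d)) (p : Fin (suc m)) (μ : Fin m → Carrier) →
      (∀ t → v (punchIn p t) zero ≈ μ t * v p zero) →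
      LinIndep F v → LinIndep F (eliminate v p μ)
    LinIndep-eliminate {m} {d} v p μ first-column li cs Σ≈0 t = begin
      cs t                 ≡⟨ insertAt-punchIn cs p (- B) t ⟨
      cs′ (punchIn p t)    ≈⟨ li cs′ relation (punchIn p t) ⟩
      0#                   ∎
      where
      B : Carrier
      B = sumFin F m (λ t → cs t * μ t)
      cs′ : Fin (suc m) → Carrier
      cs′ = insertAt cs p (- B)
      expand : ∀ i → linComb F cs′ v i ≈ sumFin F m (λ t → cs t * (v (punchIn p t) i - μ t * v p i))
      expand i = begin
        sumFin F (suc m) (λ j → cs′ j * v j i)
          ≈⟨ sumFin-remove p (λ j → cs′ j * v j i) ⟩
        cs′ p * v p i + sumFin F m (λ t → cs′ (punchIn p t) * v (punchIn p t) i)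
          ≈⟨ +-cong (*-congʳ (reflexive (insertAt-lookup cs p (- B))))
               (sumFin-cong m (λ t → *-congʳ (reflexive (insertAt-punchIn cs p (- B) t)))) ⟩
        - B * v p i + sumFin F m (λ t → cs t * v (punchIn p t) i)
          ≈⟨ +-comm _ _ ⟩
        sumFin F m (λ t → cs t * v (punchIn p t) i) + - B * v p i
          ≈⟨ +-congˡ (-‿distribˡ-* B (v p i)) ⟨
        sumFin F m (λ t → cs t * v (punchIn p t) i) - B * v p i
          ≈⟨ sumFin-linear m cs (λ t → v (punchIn p t) i) μ (v p i) ⟨
        sumFin F m (λ t → cs t * (v (punchIn p t) i - μ t * v p i)) ∎
      relation : linComb F cs′ v ≋ 0ᵥ F (suc d)
      relation zero    = trans (expand zero) (sumFin-zero m (λ t → trans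
        (*-congˡ (trans (+-congˡ (-‿cong (sym (first-column t)))) (-‿inverseʳ _))) (zeroʳ (cs t))))
      relation (suc i) = trans (expand (suc i)) (Σ≈0 i)

    pivot : ∀ {m d} (v : Fin (suc m) → V (suc d)) →
      ∃₂ λ p (μ : Fin m → Carrier) → ∀ t → v (punchIn p t) zero ≈ μ t * v p zero
    -- A vanishing first column is handled by any pivot with all multipliers 0.
    pivot v with FinP.all? (λ j → v j zero ≟ 0#)
    ... | yes column≈0 = zero , (λ _ → 0#) , λ t → trans (column≈0 (suc t)) (sym (zeroˡ _))
    ... | no column≉0 with FinP.¬∀⟶∃¬ _ _ (λ j → v j zero ≟ 0#) column≉0
    ... | p , vₚ≉0 = p , (λ t → v (punchIn p t) zero * inv (v p zero) vₚ≉0) , λ t → begin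
      v (punchIn p t) zero                               ≈⟨ *-identityʳ _ ⟨
      v (punchIn p t) zero * 1#                          ≈⟨ *-congˡ (inv-inverseˡ _ vₚ≉0) ⟨
      v (punchIn p t) zero * (inv (v p zero) vₚ≉0 * _)   ≈⟨ *-assoc _ _ _ ⟨
      v (punchIn p t) zero * inv (v p zero) vₚ≉0 * _     ∎

    suc-vectors-dependent : ∀ d (v : Fin (suc d) → V d) → ¬ LinIndep F v
    suc-vectors-dependent zero    v li = 0≉1 (sym (li (λ _ → 1#) (λ ()) zero))
    suc-vectors-dependent (suc d) v li =
      let p , μ , first-column = pivot v
      in suc-vectors-dependent d (eliminate v p μ) (LinIndep-eliminate v p μ first-column li)

    LinIndep-exchange : ∀ {n k l} (u w : Fin k → V n) {t s : Fin k} {c} → s ≢ t → ¬ c ≈ 0# →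
      (∀ y → y ≢ t → w y ≋ u y) → w t ≋ scale F c (u s) →
      (∃ λ (g : Fin l → Fin k) → InjectiveFin g × LinIndep F (w ∘ g)) →
      ∃ λ (g : Fin l → Fin k) → InjectiveFin g × LinIndep F (u ∘ g)
    LinIndep-exchange {k = k} {l} u w {t} {s} {c} s≢t c≉0 w≋u wₜ≋cuₛ (g , g-injective , li)
      with FinP.any? (λ v → g v FinP.≟ t)
    ... | no t∉g = g , g-injective , LinIndep-resp (λ v y → sym (w≋u (g v) (λ gv≡t → t∉g (v , gv≡t)) y)) li
    ... | yes (v₀ , gv₀≡t) = g′ , updateAt-injective v₀ g-injective s∉g , LinIndep-scale rescale li
      where
      g′ : Fin l → Fin k
      g′ = updateAt g v₀ (const s)
      s∉g : ∀ v → g v ≢ s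
      s∉g v gv≡s = s≢t (≡.trans (≡.sym gv≡s) (≡.trans (≡.cong g v≡v₀) gv₀≡t))
        where
        v≡v₀ : v ≡ v₀
        v≡v₀ = ≡.sym (LinIndep⇒parallel⇒≡ li (λ y → trans (reflexive (≡.cong (λ x → w x y) gv₀≡t))
          (trans (wₜ≋cuₛ y) (*-congˡ (sym (trans (reflexive (≡.cong (λ x → w x y) gv≡s)) (w≋u s s≢t y)))))))
      rescale : ∀ v → ∃ λ b → ¬ b ≈ 0# × u (g′ v) ≋ scale F b (w (g v))
      rescale v with v FinP.≟ v₀
      ... | yes ≡.refl = inv c c≉0 , inv≉0 c c≉0 , λ y →
        trans (reflexive (≡.cong (λ x → u x y) (updateAt-updates v₀ g)))
              (trans (scale-invert c≉0 wₜ≋cuₛ y) (*-congˡ (reflexive (≡.cong (λ x → w x y) (≡.sym gv₀≡t)))))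
      ... | no v≢v₀ = 1# , 0≉1 ∘ sym , λ y →
        trans (reflexive (≡.cong (λ x → u x y) (updateAt-minimal v v₀ g v≢v₀)))
              (trans (sym (w≋u (g v) (v≢v₀ ∘ (λ gv≡t → g-injective v v₀ (≡.trans gv≡t (≡.sym gv₀≡t)))) y))
                     (sym (*-identityˡ _)))

    nonzero-subfamily : ∀ {k d} (ι : Fin (suc k) → V d) → (∀ i j → ι i ≋ ι j → i ≡ j) →
      ∃ λ (κ : Fin k → V d) → (∀ i j → κ i ≋ κ j → i ≡ j) × (∀ i → ¬ κ i ≋ 0ᵥ F d)
    nonzero-subfamily {d = d} ι ι-injective with FinP.any? (λ z → ι z ≋? 0ᵥ F d)
    ... | yes (z , ιz≋0) = ι ∘ punchIn z , (λ i j → FinP.punchIn-injective z i j ∘ ι-injective _ _) ,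
          λ i ιᵢ≋0 → FinP.punchInᵢ≢i z i (ι-injective _ _ (λ x → trans (ιᵢ≋0 x) (sym (ιz≋0 x))))
    ... | no ¬∃ = ι ∘ suc , (λ i j → FinP.suc-injective ∘ ι-injective _ _) , λ i ιᵢ≋0 → ¬∃ (suc i , ιᵢ≋0)

    covering⇒¬EveryKSubsetHasIndep : ∀ {k d e m} (S : Fin m → V (d ℕ.+ e)) →
      (∀ x → ¬ x ≋ 0ᵥ F (d ℕ.+ e) → ∃ λ i → S i ≋ x) →
      (κ : Fin k → V d) → (∀ i j → κ i ≋ κ j → i ≡ j) → (∀ i → ¬ κ i ≋ 0ᵥ F d) →
      ¬ EveryKSubsetHasIndep F k (suc d) S
    covering⇒¬EveryKSubsetHasIndep {k} {d} {e} {m} S covers κ κ-injective κ≉0 indep =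
      suc-vectors-dependent d (κ ∘ g) (LinIndep-++ (κ ∘ g) (LinIndep-resp (λ v y → sym (found (g v) y)) li))
      where
      X : Fin k → V (d ℕ.+ e)
      X t = κ t ++ 0ᵥ F e
      X-restrict : ∀ t x → X t (x ↑ˡ e) ≈ κ t x
      X-restrict t x = reflexive (lookup-++ˡ (κ t) (0ᵥ F e) x)
      X≉0 : ∀ t → ¬ X t ≋ 0ᵥ F (d ℕ.+ e)
      X≉0 t X≋0 = κ≉0 t (λ x → trans (sym (X-restrict t x)) (X≋0 (x ↑ˡ e)))
      index : Fin k → Fin m
      index t = proj₁ (covers (X t) (X≉0 t))
      found : ∀ t → S (index t) ≋ X t
      found t = proj₂ (covers (X t) (X≉0 t))
      index-injective : InjectiveFin index
      index-injective t t′ eq = κ-injective t t′ λ x → begin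
        κ t x                   ≈⟨ X-restrict t x ⟨
        X t (x ↑ˡ e)            ≈⟨ found t (x ↑ˡ e) ⟨
        S (index t) (x ↑ˡ e)    ≡⟨ ≡.cong (λ i → S i (x ↑ˡ e)) eq ⟩
        S (index t′) (x ↑ˡ e)   ≈⟨ found t′ (x ↑ˡ e) ⟩
        X t′ (x ↑ˡ e)           ≈⟨ X-restrict t′ x ⟩
        κ t′ x                  ∎
      g : Fin (suc d) → Fin k
      g = proj₁ (indep index index-injective)
      li : LinIndep F (λ v → S (index (g v)))
      li = proj₂ (proj₂ (indep index index-injective))

    Saturated : ∀ {n m r} → (Fin m → V n) → (Fin r → V n) → Set (c ⊔ ℓ)
    Saturated S P = ∀ j a → ¬ a ≈ 0# → ∃ λ i → S i ≋ scale F a (P j)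

    module _ {n k l m} {S : Fin m → V n} (SI : IsIndepSet F n k l m S) (R : ProjectiveReps S) where
      open ProjectiveReps R

      private
        P : Fin count → V n
        P = S ∘ rep
        S≉0 : ∀ i → ¬ S i ≋ 0ᵥ F n
        S≉0 = proj₁ SI
        indep : EveryKSubsetHasIndep F k l S
        indep = proj₂ (proj₂ SI)

      ∷-reps-distinct : ∀ {x} → (∀ j → ¬ x ∥ P j) → ∀ j j′ → (x ∷ P) j ∥ (x ∷ P) j′ → j ≡ j′
      ∷-reps-distinct x∦P zero    zero     _   = ≡.refl
      ∷-reps-distinct x∦P zero    (suc j′) x∥P = contradiction x∥P (x∦P j′)
      ∷-reps-distinct x∦P (suc j) zero     P∥x = contradiction (∥-sym (S≉0 (rep j)) P∥x) (x∦P j)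
      ∷-reps-distinct x∦P (suc j) (suc j′) P∥P = ≡.cong suc (rep-distinct j j′ P∥P)

      ∷-reps-subset-avoiding-head : ∀ x (f : Fin k → Fin (suc count)) → InjectiveFin f → (∀ t → zero ≢ f t) →
        ∃ λ (g : Fin l → Fin k) → InjectiveFin g × LinIndep F (λ v → (x ∷ P) (f (g v)))
      ∷-reps-subset-avoiding-head x f f-injective f≢0 =
        let g , g-injective , li = proj₂ (proj₂ (reps-proIndep SI R)) f′ f′-injective
        in g , g-injective , LinIndep-resp (λ v y →
             reflexive (≡.cong (λ j → (x ∷ P) j y) (≡.sym (FinP.punchIn-punchOut (f≢0 (g v)))))) li
        where
        f′ : Fin k → Fin count
        f′ t = punchOut (f≢0 t)
        f′-injective : InjectiveFin f′
        f′-injective t t′ = f-injective t t′ ∘ FinP.punchOut-injective (f≢0 t) (f≢0 t′)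

      ∷-reps-subset-through-head : 2 ≤ k → Saturated S P → ∀ {c} → ¬ c ≈ 0# → ¬ c ≈ 1# →
        ∀ x (f : Fin k → Fin (suc count)) → InjectiveFin f → ∀ t → f t ≡ zero →
        ∃ λ (g : Fin l → Fin k) → InjectiveFin g × LinIndep F (λ v → (x ∷ P) (f (g v)))
      ∷-reps-subset-through-head 2≤k saturated {c} c≉0 c≉1 x f f-injective t ft≡0 =
        LinIndep-exchange ((x ∷ P) ∘ f) (S ∘ pick ∘ f) s≢t c≉0 agree swapped (indep (pick ∘ f) pick∘f-injective)
        where
        s : Fin k
        s = proj₁ (2≤n⇒∃≢ 2≤k t)
        s≢t : s ≢ t
        s≢t = proj₂ (2≤n⇒∃≢ 2≤k t)
        fs≢0 : zero ≢ f s
        fs≢0 0≡fs = s≢t (f-injective s t (≡.trans (≡.sym 0≡fs) (≡.sym ft≡0)))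
        js : Fin count
        js = punchOut fs≢0
        i₀ : Fin m
        i₀ = proj₁ (saturated js c c≉0)
        S-i₀ : S i₀ ≋ scale F c (P js)
        S-i₀ = proj₂ (saturated js c c≉0)
        i₀∉rep : ∀ j → i₀ ≢ rep j
        i₀∉rep j i₀≡repj = c≉1 (scale-fixed⇒≈1 (S≉0 (rep js))
          (λ y → trans (reflexive (≡.cong (λ i → S i y) (≡.sym (≡.trans i₀≡repj (≡.cong rep j≡js))))) (S-i₀ y)))
          where
          j≡js : j ≡ js
          j≡js = rep-distinct j js (c , λ y → trans (reflexive (≡.cong (λ i → S i y) (≡.sym i₀≡repj))) (S-i₀ y))
        pick : Fin (suc count) → Fin m
        pick = i₀ ∷ rep
        pick-injective : InjectiveFin pick
        pick-injective zero    zero     _  = ≡.refl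
        pick-injective zero    (suc j′) eq = contradiction eq (i₀∉rep j′)
        pick-injective (suc j) zero     eq = contradiction (≡.sym eq) (i₀∉rep j)
        pick-injective (suc j) (suc j′) eq = ≡.cong suc (rep-injective j j′ eq)
        pick∘f-injective : InjectiveFin (pick ∘ f)
        pick∘f-injective y y′ = f-injective y y′ ∘ pick-injective _ _
        pick-agrees : ∀ z → z ≢ zero → S (pick z) ≋ (x ∷ P) z
        pick-agrees zero    z≢0 = contradiction ≡.refl z≢0
        pick-agrees (suc j) _   = λ _ → refl
        agree : ∀ y → y ≢ t → S (pick (f y)) ≋ (x ∷ P) (f y)
        agree y y≢t = pick-agrees (f y) (λ fy≡0 → y≢t (f-injective y t (≡.trans fy≡0 (≡.sym ft≡0))))
        swapped : S (pick (f t)) ≋ scale F c ((x ∷ P) (f s))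
        swapped y = trans (reflexive (≡.cong (λ z → S (pick z) y) ft≡0))
          (trans (S-i₀ y) (*-congˡ (reflexive (≡.cong (λ z → (x ∷ P) z y) (FinP.punchIn-punchOut fs≢0)))))

      extend-proIndep : 2 ≤ k → Saturated S P → ∀ {c} → ¬ c ≈ 0# → ¬ c ≈ 1# →
        ∀ {x} → ¬ x ≋ 0ᵥ F n → (∀ j → ¬ x ∥ P j) → IsProIndepSet F n k l (suc count) (x ∷ P)
      extend-proIndep 2≤k saturated c≉0 c≉1 {x} x≉0 x∦P = x∷P≉0 , ∷-reps-distinct x∦P , x∷P-indep
        where
        x∷P≉0 : ∀ j → ¬ (x ∷ P) j ≋ 0ᵥ F n
        x∷P≉0 zero    = x≉0
        x∷P≉0 (suc j) = S≉0 (rep j)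
        x∷P-indep : EveryKSubsetHasIndep F k l (x ∷ P)
        x∷P-indep f f-injective with FinP.any? (λ t → f t FinP.≟ zero)
        ... | no x∉f         = ∷-reps-subset-avoiding-head x f f-injective (λ t 0≡ft → x∉f (t , ≡.sym 0≡ft))
        ... | yes (t , ft≡0) = ∷-reps-subset-through-head 2≤k saturated c≉0 c≉1 x f f-injective t ft≡0

  module FiniteField (q′ : ℕ) (FF : IsFiniteField F (suc q′)) where
    open IsFiniteField FF

    private
      index : Carrier → Fin (suc q′)
      index a = proj₁ (enum-surjective a)

      ≈enum-index : ∀ a → a ≈ enum (index a)
      ≈enum-index a = proj₂ (enum-surjective a)

    _≟_ : Decidable _≈_
    a ≟ b = map′ (λ eq → trans (≈enum-index a) (trans (reflexive (≡.cong enum eq)) (sym (≈enum-index b))))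
                 (λ a≈b → enum-injective _ _ (trans (sym (≈enum-index a)) (trans a≈b (≈enum-index b))))
                 (index a FinP.≟ index b)

    open DiscreteField 0≉1 inverse _≟_

    infix 4 _∥?_
    _∥?_ : ∀ {n} → Decidable (_∥_ {n})
    u ∥? v = map′ (λ (i , u≋iv) → enum i , u≋iv)
                  (λ (a , u≋av) → index a , λ y → trans (u≋av y) (*-congʳ (≈enum-index a)))
                  (FinP.any? (λ i → u ≋? scale F (enum i) v))

    projectiveReps : ∀ {n m} (S : Fin m → V n) → (∀ i → ¬ S i ≋ 0ᵥ F n) → ProjectiveReps S
    projectiveReps {m = zero} S _ = record { count = 0 ; rep = λ () ; rep-distinct = λ () ; rep-covers = λ () }
    projectiveReps {m = suc m} S S≉0 = add-first (projectiveReps (S ∘ suc) (S≉0 ∘ suc))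
      where
      add-first : ProjectiveReps (S ∘ suc) → ProjectiveReps S
      add-first R with FinP.any? (λ j → S zero ∥? S (suc (ProjectiveReps.rep R j)))
      ... | yes (j , S₀∥) = record
        { count = count ; rep = suc ∘ rep ; rep-distinct = rep-distinct
        ; rep-covers = λ { zero → j , S₀∥ ; (suc i) → rep-covers i } }
        where open ProjectiveReps R
      ... | no S₀∦ = record
        { count = suc count ; rep = zero ∷ suc ∘ rep ; rep-distinct = distinct
        ; rep-covers = λ { zero → zero , ∥-refl (S zero) ; (suc i) → let j , Sᵢ∥ = rep-covers i in suc j , Sᵢ∥ } }
        where
        open ProjectiveReps R
        distinct : ∀ j j′ → S ((zero ∷ suc ∘ rep) j) ∥ S ((zero ∷ suc ∘ rep) j′) → j ≡ j′
        distinct zero    zero     _  = ≡.refl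
        distinct zero    (suc j′) S∥ = contradiction (j′ , S∥) S₀∦
        distinct (suc j) zero     S∥ = contradiction (j , ∥-sym (S≉0 _) S∥) S₀∦
        distinct (suc j) (suc j′) S∥ = ≡.cong suc (rep-distinct j j′ S∥)

    private
      z₀ : Fin (suc q′)
      z₀ = index 0#

    nonzeroScalar : Fin q′ → Carrier
    nonzeroScalar t = enum (punchIn z₀ t)

    nonzeroScalar≉0 : ∀ t → ¬ nonzeroScalar t ≈ 0#
    nonzeroScalar≉0 t eq = FinP.punchInᵢ≢i z₀ t (enum-injective _ _ (trans eq (≈enum-index 0#)))

    nonzeroScalar-injective : ∀ t t′ → nonzeroScalar t ≈ nonzeroScalar t′ → t ≡ t′
    nonzeroScalar-injective t t′ = FinP.punchIn-injective z₀ t t′ ∘ enum-injective _ _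

    nonzeroIndex : ∀ a → ¬ a ≈ 0# → Fin q′
    nonzeroIndex a a≉0 = punchOut z₀≢index
      where
      z₀≢index : z₀ ≢ index a
      z₀≢index eq = a≉0 (trans (≈enum-index a) (trans (reflexive (≡.cong enum (≡.sym eq))) (sym (≈enum-index 0#))))

    ≈nonzeroScalar-nonzeroIndex : ∀ a (a≉0 : ¬ a ≈ 0#) → a ≈ nonzeroScalar (nonzeroIndex a a≉0)
    ≈nonzeroScalar-nonzeroIndex a a≉0 =
      trans (≈enum-index a) (reflexive (≡.cong enum (≡.sym (FinP.punchIn-punchOut _))))

    units≈1 : (∀ (t t′ : Fin q′) → t ≡ t′) → ∀ a → ¬ a ≈ 0# → a ≈ 1#
    units≈1 unique a a≉0 = trans (≈nonzeroScalar-nonzeroIndex a a≉0)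
      (trans (reflexive (≡.cong nonzeroScalar (unique _ _))) (sym (≈nonzeroScalar-nonzeroIndex 1# (0≉1 ∘ sym))))

    2≤q′⇒∃unit≉1 : 2 ≤ q′ → ∃ λ c → ¬ c ≈ 0# × ¬ c ≈ 1#
    2≤q′⇒∃unit≉1 2≤q′ with 2≤n⇒∃≢ 2≤q′ (nonzeroIndex 1# (0≉1 ∘ sym))
    ... | t , t≢t₁ = nonzeroScalar t , nonzeroScalar≉0 t ,
      λ c≈1 → t≢t₁ (nonzeroScalar-injective t _ (trans c≈1 (≈nonzeroScalar-nonzeroIndex 1# (0≉1 ∘ sym))))

    vectors : ∀ d → Fin (suc q′ ^ d) → V d
    vectors d x = enum ∘ finToFun x

    vectors-injective : ∀ d x y → vectors d x ≋ vectors d y → x ≡ y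
    vectors-injective d x y eq = finToFun-injective (λ i → enum-injective _ _ (eq i))

    nonzero-vectors : ∀ {k d} → k < suc q′ ^ d →
      ∃ λ (κ : Fin k → V d) → (∀ i j → κ i ≋ κ j → i ≡ j) × (∀ i → ¬ κ i ≋ 0ᵥ F d)
    nonzero-vectors {d = d} k<q^d = nonzero-subfamily (λ i → vectors d (inject≤ i k<q^d))
      (λ i j → FinP.inject≤-injective k<q^d k<q^d i j ∘ vectors-injective d _ _)

    module _ {n k l m} {S : Fin m → V n} (SI : IsIndepSet F n k l m S) (R : ProjectiveReps S) where
      open ProjectiveReps R

      private
        class : Fin m → Fin count
        class i = proj₁ (rep-covers i)

        coefficient : Fin m → Carrier
        coefficient i = proj₁ (proj₂ (rep-covers i))

        S≋coefficient·rep : ∀ i → S i ≋ scale F (coefficient i) (S (rep (class i)))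
        S≋coefficient·rep i = proj₂ (proj₂ (rep-covers i))

        coefficient≉0 : ∀ i → ¬ coefficient i ≈ 0#
        coefficient≉0 i = scale-coefficient≉0 (proj₁ SI i) (S≋coefficient·rep i)

      encode : Fin m → Fin (count ℕ.* q′)
      encode i = combine (class i) (nonzeroIndex (coefficient i) (coefficient≉0 i))

      encode-sound : ∀ i {j t} → encode i ≡ combine j t → S i ≋ scale F (nonzeroScalar t) (S (rep j))
      encode-sound i {j} {t} eq y with FinP.combine-injective (class i) _ j t eq
      ... | ≡.refl , ≡.refl =
        trans (S≋coefficient·rep i y) (*-congʳ (≈nonzeroScalar-nonzeroIndex (coefficient i) (coefficient≉0 i)))

      encode-injective : InjectiveFin encode
      encode-injective i i′ eq = proj₁ (proj₂ SI) i i′ (λ y → trans (encode-sound i eq y) (sym (encode-sound i′ ≡.refl y)))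

      size≤count*[q-1] : m ≤ count ℕ.* q′
      size≤count*[q-1] = FinP.injective⇒≤ (encode-injective _ _)

      saturated : count ℕ.* q′ ≤ m → Saturated S (S ∘ rep)
      saturated full j a a≉0 with injective⇒surjective encode-injective full (combine j (nonzeroIndex a a≉0))
      ... | i , encoded = i , λ y → trans (encode-sound i encoded y) (*-congʳ (sym (≈nonzeroScalar-nonzeroIndex a a≉0)))

      covering : 2 ≤ k → 2 ≤ q′ → Saturated S (S ∘ rep) →
        (∀ m′ (S′ : Fin m′ → V n) → IsProIndepSet F n k l m′ S′ → m′ ≤ count) →
        ∀ x → ¬ x ≋ 0ᵥ F n → ∃ λ i → S i ≋ x
      covering 2≤k 2≤q′ sat pro-maximal x x≉0 with FinP.any? (λ j → x ∥? S (rep j))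
      ... | yes (j , a , x≋aP) =
        let i , Sᵢ≋aP = sat j a (scale-coefficient≉0 x≉0 x≋aP) in i , λ y → trans (Sᵢ≋aP y) (sym (x≋aP y))
      ... | no x∦P =
        let _ , γ≉0 , γ≉1 = 2≤q′⇒∃unit≉1 2≤q′
        in contradiction (pro-maximal (suc count) (x ∷ S ∘ rep)
             (extend-proIndep SI R 2≤k sat γ≉0 γ≉1 x≉0 (λ j x∥ → x∦P (j , x∥)))) (ℕ.n≮n count)

    Ind≢[q-1]*IndPro : ∀ {n k d m mp} → 2 ≤ q′ → 2 ≤ k → d ≤ n → k < suc q′ ^ d →
      IsInd F n k (suc d) m → IsIndPro F n k (suc d) mp → m ≢ q′ ℕ.* mp
    Ind≢[q-1]*IndPro {d = d} {m} {mp} 2≤q′ 2≤k d≤n k<q^d ((S , SI) , _) (_ , pro-maximal) m≡q′*mp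
      with ℕ.m≤n⇒∃[o]m+o≡n d≤n
    ... | e , ≡.refl =
      let κ , κ-injective , κ≉0 = nonzero-vectors k<q^d
      in covering⇒¬EveryKSubsetHasIndep S covers κ κ-injective κ≉0 (proj₂ (proj₂ SI))
      where
      R : ProjectiveReps S
      R = projectiveReps S (proj₁ SI)
      open ProjectiveReps R
      m≡mp*q′ : m ≡ mp ℕ.* q′
      m≡mp*q′ = ≡.trans m≡q′*mp (ℕ.*-comm q′ mp)
      count≤mp : count ≤ mp
      count≤mp = pro-maximal count (S ∘ rep) (reps-proIndep SI R)
      mp≤count : mp ≤ count
      mp≤count = ℕ.*-cancelʳ-≤ mp count q′ {{ℕ.>-nonZero (ℕ.≤-trans (s≤s z≤n) 2≤q′)}}
        (≡.subst (_≤ count ℕ.* q′) m≡mp*q′ (size≤count*[q-1] SI R))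
      full : count ℕ.* q′ ≤ m
      full = ≡.subst (count ℕ.* q′ ≤_) (≡.sym m≡mp*q′) (ℕ.*-monoˡ-≤ q′ count≤mp)
      covers : ∀ x → ¬ x ≋ 0ᵥ F (d ℕ.+ e) → ∃ λ i → S i ≋ x
      covers = covering SI R 2≤k 2≤q′ (saturated SI R full)
        (λ m′ S′ pro → ℕ.≤-trans (pro-maximal m′ S′ pro) mp≤count)

open import Data.Nat using (_*_)

proposition2p16 : ∀ {c ℓ} (F : CommutativeRing c ℓ) (q : ℕ) → IsFiniteField F q →
    (n k l : ℕ) → 2 ≤ l → l ≤ k → k * (q ∸ 1) ≤ q ^ n ∸ 1 → l ≤ n →
    k * (q ∸ 1) ≤ q ^ (l ∸ 1) ∸ 1 →
    (m mp : ℕ) → IsInd F n k l m → IsIndPro F n k l mp →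
    (m ≡ (q ∸ 1) * mp) ⇔ (q ≡ 2)
proposition2p16 F zero FF _ _ _ _ _ _ _ _ _ _ _ _ = contradiction (IsFiniteField⇒2≤q F FF) λ ()
proposition2p16 F (suc zero) FF _ _ _ _ _ _ _ _ _ _ _ _ = contradiction (IsFiniteField⇒2≤q F FF) λ { (s≤s ()) }
proposition2p16 F 2 FF _ _ _ _ _ _ _ _ _ mp ind indPro =
  mk⇔ (λ _ → ≡.refl) (λ _ →
    ≡.trans (isInd∧isIndPro⇒≡ F (FiniteField.units≈1 F 1 FF fin1-unique) ind indPro) (≡.sym (ℕ.*-identityˡ mp)))
  where
  fin1-unique : ∀ (t t′ : Fin 1) → t ≡ t′
  fin1-unique zero zero = ≡.refl
proposition2p16 F q@(suc (suc (suc q″))) FF n k (suc d) 2≤l l≤k _ l≤n k[q-1]≤q^d-1 _ _ ind indPro =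
  mk⇔ (⊥-elim ∘ FiniteField.Ind≢[q-1]*IndPro F (suc (suc q″)) FF (s≤s (s≤s z≤n)) 2≤k d≤n k<q^d ind indPro) (λ ())
  where
  2≤k : 2 ≤ k
  2≤k = ℕ.≤-trans 2≤l l≤k
  d≤n : d ≤ n
  d≤n = ℕ.≤-trans (ℕ.n≤1+n d) l≤n
  k<q^d : k < q ^ d
  k<q^d = ≤∸1⇒< (ℕ.m^n>0 q d) (ℕ.≤-trans (ℕ.m≤m*n k (suc (suc q″))) k[q-1]≤q^d-1)
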